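{- Let $n$ be a positive integer with $n\notin\mathcal{E}$, let $k=\lceil\log_3 n\rceil$, and let $m$ be an integer with $n\le m<3^k<3n$. Suppose that $m=3^{r}\cdot 7$ with $r\ge 0$ an integer. Then there exist integers $1\le a<b\le n$ such that $b^3+b\equiv a^3+a\pmod{m}$.
   Context: $\mathcal{E}=\{3^{6s+5}+1:\ s\in \{0,1,2,\dots\}\}\cup\{3^{6s+5}+2:\ s\in \{0,1,2,\dots\}\}$. $\lceil x\rceil$ denotes the smallest integer no less than $x$. -}

module Defs where

open import Data.Nat using (ℕ; _+_; _*_; _^_; _≤_)
open import Data.Product using (Σ; _×_)
open import Data.Sum using (_⊎_)
open import Relation.Binary.PropositionalEquality using (_≡_)

InE : ℕ → Set
InE n = Σ ℕ (λ s → (n ≡ 3 ^ (6 * s + 5) + 1) ⊎ (n ≡ 3 ^ (6 * s + 5) + 2))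

IsCeilLog3 : ℕ → ℕ → Set
IsCeilLog3 n k = (n ≤ 3 ^ k) × (∀ j → n ≤ 3 ^ j → k ≤ j)

{-# OPTIONS --safe #-}
-- With R = 3 ^ r and b = a + t * R we have b³ + b - (a³ + a) = t R (3a² + 3atR + t²R² + 1), so it is
-- enough that 7 divides the second factor. That factor depends only on R mod 7, i.e. on r mod 6
-- (3 has order 6 modulo 7), and for the six residues the pairs (a , t) = (1 , 2), (1 , 3), (1 , 1),
-- (3 , 2), (3 , 3), (3 , 1) work. The hypotheses give 7R < 3 ^ k < 3n, hence 3R < n, which makes
-- b ≤ n except for r ≡ 4 (mod 6): there b = 3 ^ (r + 1) + 3 and one needs n ∉ 𝓔.
module Submission where

open import Defs
open import Data.Nat using (ℕ; NonZero; zero; suc; _+_; _*_; _^_; _≤_; _<_; z≤n; s≤s; z<s; _/_; _%_)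
open import Data.Nat.Properties
open import Data.Nat.DivMod using (m≡m%n+[m/n]*n; m%n<n)
open import Data.Nat.Divisibility as ℕ using (∣m∣n⇒∣m+n; m∣m*n; ∣n⇒∣m*n; *-monoʳ-∣; divides)
open import Data.Nat.Tactic.RingSolver using (solve-∀)
open import Data.Integer using (+_) renaming (_-_ to _-ℤ_)
open import Data.Integer.Properties using ([+m]-[+n]≡m⊖n; ⊖-≥)
import Data.Integer as ℤ
open import Data.Integer.Divisibility using (_∣_)
open import Data.Product using (Σ; ∃-syntax; _×_; _,_)
open import Data.Sum using (inj₁; inj₂)
open import Relation.Nullary using (¬_; contradiction)
open import Relation.Binary.PropositionalEquality
  using (_≡_; _≢_; refl; sym; trans; cong; subst; module ≡-Reasoning)

cubePlus : ℕ → ℕ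
cubePlus x = x ^ 3 + x

cubePlusSlope : ℕ → ℕ → ℕ
cubePlusSlope a d = 3 * a * a + 3 * a * d + d * d + 1

cubePlus-+ : ∀ a d → cubePlus (a + d) ≡ cubePlus a + d * cubePlusSlope a d
cubePlus-+ = expand
  where
  expand : ∀ a d → (a + d) * ((a + d) * ((a + d) * 1)) + (a + d) ≡ a * (a * (a * 1)) + a + d * (3 * a * a + 3 * a * d + d * d + 1)
  expand = solve-∀

cubePlusSlope-*[1+m*q] : ∀ m a d q → cubePlusSlope a (d * (1 + m * q)) ≡
  cubePlusSlope a d + m * (3 * a * d * q + d * d * (2 * q + m * q * q))
cubePlusSlope-*[1+m*q] = expand
  where
  expand : ∀ m a d q →
    3 * a * a + 3 * a * (d * (1 + m * q)) + d * (1 + m * q) * (d * (1 + m * q)) + 1 ≡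
    3 * a * a + 3 * a * d + d * d + 1 + m * (3 * a * d * q + d * d * (2 * q + m * q * q))
  expand = solve-∀

cubePlusSlope-mod : ∀ m a d q → m ℕ.∣ cubePlusSlope a d → m ℕ.∣ cubePlusSlope a (d * (1 + m * q))
cubePlusSlope-mod m a d q m∣ = subst (m ℕ.∣_) (sym (cubePlusSlope-*[1+m*q] m a d q)) (∣m∣n⇒∣m+n m∣ (m∣m*n _))

[1+m*x]^s≡1+m*q : ∀ m x s → ∃[ q ] (1 + m * x) ^ s ≡ 1 + m * q
[1+m*x]^s≡1+m*q m x zero = 0 , cong suc (sym (*-zeroʳ m))
[1+m*x]^s≡1+m*q m x (suc s) with [1+m*x]^s≡1+m*q m x s
... | q , eq = x + q + m * x * q , trans (cong ((1 + m * x) *_) eq) (expand m x q)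
  where
  expand : ∀ m x q → (1 + m * x) * (1 + m * q) ≡ 1 + m * (x + q + m * x * q)
  expand = solve-∀

-- 3 ^ 6 = 729 = 1 + 7 * 104
3^[i+s*6]≡3^i*[1+7*q] : ∀ i s → ∃[ q ] 3 ^ (i + s * 6) ≡ 3 ^ i * (1 + 7 * q)
3^[i+s*6]≡3^i*[1+7*q] i s with [1+m*x]^s≡1+m*q 7 104 s
... | q , eq = q , (begin
  3 ^ (i + s * 6)       ≡⟨ ^-distribˡ-+-* 3 i (s * 6) ⟩
  3 ^ i * 3 ^ (s * 6)   ≡⟨ cong (λ e → 3 ^ i * 3 ^ e) (*-comm s 6) ⟩
  3 ^ i * 3 ^ (6 * s)   ≡⟨ cong (3 ^ i *_) (sym (^-*-assoc 3 6 s)) ⟩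
  3 ^ i * 729 ^ s       ≡⟨ cong (3 ^ i *_) eq ⟩
  3 ^ i * (1 + 7 * q)   ∎)
  where open ≡-Reasoning

cubePlusSlope-periodic : ∀ a t i s → 7 ℕ.∣ cubePlusSlope a (t * 3 ^ i) →
  7 ℕ.∣ cubePlusSlope a (t * 3 ^ (i + s * 6))
cubePlusSlope-periodic a t i s 7∣ with 3^[i+s*6]≡3^i*[1+7*q] i s
... | q , eq rewrite eq | sym (*-assoc t (3 ^ i) (1 + 7 * q)) = cubePlusSlope-mod 7 a (t * 3 ^ i) q 7∣

∣+[m+n]-+m∣≡n : ∀ m n → ℤ.∣ + (m + n) -ℤ + m ∣ ≡ n
∣+[m+n]-+m∣≡n m n = trans (cong ℤ.∣_∣ (trans ([+m]-[+n]≡m⊖n (m + n) m) (⊖-≥ (m≤m+n m n)))) (m+n∸m≡n m n)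

cubePlus-shift-divisible : ∀ m a t R → m ℕ.∣ cubePlusSlope a (t * R) →
  (+ (R * m)) ∣ (+ cubePlus (a + t * R) -ℤ + cubePlus a)
cubePlus-shift-divisible m a t R m∣
  rewrite cubePlus-+ a (t * R) | ∣+[m+n]-+m∣≡n (cubePlus a) (t * R * cubePlusSlope a (t * R))
  = subst (R * m ℕ.∣_) (reassoc R t (cubePlusSlope a (t * R))) (*-monoʳ-∣ R (∣n⇒∣m*n t m∣))
  where
  reassoc : ∀ R t S → R * (t * S) ≡ t * R * S
  reassoc = solve-∀

^-cancelʳ-< : ∀ m .{{_ : NonZero m}} {j k} → m ^ j < m ^ k → j < k
^-cancelʳ-< m m^j<m^k = ≰⇒> (λ k≤j → <⇒≱ m^j<m^k (^-monoʳ-≤ m k≤j))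

3^[1+r]<n : ∀ n k r → 3 ^ r * 7 < 3 ^ k → 3 ^ k < 3 * n → 3 * 3 ^ r < n
3^[1+r]<n n k r 7*3^r<3^k 3^k<3n = *-cancelˡ-< 3 (3 * 3 ^ r) n (≤-<-trans 3^[2+r]≤3^k 3^k<3n)
  where
  3^[1+r]≤7*3^r : 3 ^ (1 + r) ≤ 3 ^ r * 7
  3^[1+r]≤7*3^r = subst (3 ^ (1 + r) ≤_) (*-comm 7 (3 ^ r)) (*-monoˡ-≤ (3 ^ r) {3} {7} (s≤s (s≤s (s≤s z≤n))))
  3^[2+r]≤3^k : 3 ^ (2 + r) ≤ 3 ^ k
  3^[2+r]≤3^k = ^-monoʳ-≤ 3 {2 + r} {k} (^-cancelʳ-< 3 {1 + r} {k} (≤-<-trans 3^[1+r]≤7*3^r 7*3^r<3^k))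

3+x≤n : ∀ {x n} → x < n → n ≢ x + 1 → n ≢ x + 2 → 3 + x ≤ n
3+x≤n {x} x<n n≢x+1 n≢x+2 with m≤n⇒m<n∨m≡n x<n
... | inj₂ 1+x≡n = contradiction (trans (sym 1+x≡n) (+-comm 1 x)) n≢x+1
... | inj₁ 1+x<n with m≤n⇒m<n∨m≡n 1+x<n
...   | inj₂ 2+x≡n = contradiction (trans (sym 2+x≡n) (+-comm 2 x)) n≢x+2
...   | inj₁ 2+x<n = 2+x<n

a+t*R≤1+[u+t]*R : ∀ {a} u t R → a ≤ 1 + u * R → a + t * R ≤ 1 + (u + t) * R
a+t*R≤1+[u+t]*R {a} u t R a≤ = begin
  a + t * R             ≤⟨ +-monoˡ-≤ (t * R) a≤ ⟩
  1 + u * R + t * R     ≡⟨ cong suc (*-distribʳ-+ R u t) ⟨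
  1 + (u + t) * R       ∎
  where open ≤-Reasoning

-- b = a + t * R then satisfies 1 ≤ a < b ≤ n and 7 * R ∣ cubePlus b - cubePlus a.
record AdmissibleShift (n R : ℕ) : Set where
  field
    a t : ℕ
    1≤a : 1 ≤ a
    1≤t : 1 ≤ t
    7∣slope : 7 ℕ.∣ cubePlusSlope a (t * R)
    a+t*R≤n : a + t * R ≤ n

residueShift : ∀ {n r} s i a t → r ≡ i + s * 6 → 1 ≤ a → 1 ≤ t →
  7 ℕ.∣ cubePlusSlope a (t * 3 ^ i) → a + t * 3 ^ r ≤ n → AdmissibleShift n (3 ^ r)
residueShift s i a t r≡ 1≤a 1≤t 7∣ b≤n = record
  { a = a ; t = t ; 1≤a = 1≤a ; 1≤t = 1≤t ; a+t*R≤n = b≤n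
  ; 7∣slope = subst (λ j → 7 ℕ.∣ cubePlusSlope a (t * 3 ^ j)) (sym r≡) (cubePlusSlope-periodic a t i s 7∣)
  }

admissibleShift : ∀ n r → 3 * 3 ^ r < n → ¬ InE n → AdmissibleShift n (3 ^ r)
admissibleShift n r 3R<n ¬E = byResidue (r % 6) (m%n<n r 6) (m≡m%n+[m/n]*n r 6)
  where
  R = 3 ^ r
  within : ∀ {a t} u → a ≤ 1 + u * R → u + t ≡ 3 → a + t * R ≤ n
  within {t = t} u a≤ u+t≡3 =
    ≤-trans (a+t*R≤1+[u+t]*R u t R a≤) (subst (λ c → 1 + c * R ≤ n) (sym u+t≡3) 3R<n)
  2≤R : 1 ≤ r → 2 ≤ R
  2≤R 1≤r = ≤-trans (s≤s (s≤s z≤n)) (^-monoʳ-≤ 3 1≤r)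
  excluded : r ≡ 4 + r / 6 * 6 → 3 + 3 * R ≤ n
  excluded r≡ = 3+x≤n 3R<n
    (λ n≡ → ¬E (r / 6 , inj₁ (trans n≡ (cong (_+ 1) 3R≡))))
    (λ n≡ → ¬E (r / 6 , inj₂ (trans n≡ (cong (_+ 2) 3R≡))))
    where
    3R≡ : 3 * R ≡ 3 ^ (6 * (r / 6) + 5)
    3R≡ = cong (3 ^_) (trans (cong suc r≡) (trans (+-comm 5 (r / 6 * 6)) (cong (_+ 5) (*-comm (r / 6) 6))))
  byResidue : ∀ i → i < 6 → r ≡ i + r / 6 * 6 → AdmissibleShift n R
  byResidue 0 _ r≡ = residueShift (r / 6) 0 1 2 r≡ z<s z<s (divides 2 refl) (within 1 z<s refl)
  byResidue 1 _ r≡ = residueShift (r / 6) 1 1 3 r≡ z<s z<s (divides 16 refl) (within 0 z<s refl)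
  byResidue 2 _ r≡ = residueShift (r / 6) 2 1 1 r≡ z<s z<s (divides 16 refl) (within 2 z<s refl)
  byResidue 3 _ r≡ = residueShift (r / 6) 3 3 2 r≡ z<s z<s (divides 490 refl)
    (within 1 (s≤s (*-monoʳ-≤ 1 (2≤R (subst (1 ≤_) (sym r≡) z<s)))) refl)
  byResidue 4 _ r≡ = residueShift (r / 6) 4 3 3 r≡ z<s z<s (divides 8752 refl)
    (excluded r≡)
  byResidue 5 _ r≡ = residueShift (r / 6) 5 3 1 r≡ z<s z<s (divides 8752 refl)
    (within 2 (s≤s (*-monoʳ-≤ 2 (m^n>0 3 r))) refl)
  byResidue (suc (suc (suc (suc (suc (suc _)))))) (s≤s (s≤s (s≤s (s≤s (s≤s (s≤s ())))))) _

lemma5p4 : (n k m r : ℕ) → 1 ≤ n → ¬ InE n → IsCeilLog3 n k →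
    n ≤ m → m < 3 ^ k → 3 ^ k < 3 * n → m ≡ 3 ^ r * 7 →
    Σ ℕ (λ a → Σ ℕ (λ b → (1 ≤ a) × (a < b) × (b ≤ n) ×
    ((+ m) ∣ (+ (b ^ 3 + b) -ℤ + (a ^ 3 + a)))))
lemma5p4 n k m r _ ¬E _ _ m<3^k 3^k<3n refl =
  a , a + t * R , 1≤a , m<m+n a (*-mono-≤ 1≤t (m^n>0 3 r)) , a+t*R≤n ,
  cubePlus-shift-divisible 7 a t R 7∣slope
  where
  R = 3 ^ r
  open AdmissibleShift (admissibleShift n r (3^[1+r]<n n k r m<3^k 3^k<3n) ¬E)
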